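{- Let $q\geq 9$ be a perfect square, let $\mathcal{A}$ be an affine plane of order $q$, let $\mathcal{L}$ be a set of $q+1$ pairwise non-parallel lines of $\mathcal{A}$ and let $\mathcal{K}$ be the Kakeya set determined by $\mathcal{L}$. If $|\mathcal{K}|>q^2-q\sqrt{q}+q$, then $\mathcal{K}$ contains a $(q+1-k)$-knot for some integer $k$ with $0\leq k\leq\sqrt{q}$, and $$|\mathcal{K}|\in\left[q^2-kq+\frac{k(k+1)}{2},\ q^2-kq+k^2\right].$$
   Context: An affine plane of order $q$ is a set of $q^2$ points and $q^2+q$ lines (each line a set of $q$ points) such that any two points lie on exactly one line and any two lines meet in at most one point; its lines are partitioned into $q+1$ parallel classes, each consisting of $q$ pairwise disjoint lines. A Kakeya set is the set $\mathcal{K}$ of points covered by a set $\mathcal{L}$ of $q+1$ lines containing exactly one line from each parallel class. For an integer $j$, a $j$-knot of $\mathcal{K}$ is a point lying on exactly $j$ lines of $\mathcal{L}$. -}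

module Defs where

open import Data.Nat using (ℕ; zero; suc; _+_; _*_; _≤_)
open import Data.Fin using (Fin; zero; suc; _≟_)
open import Data.Bool using (Bool; true; false; _∧_; _∨_)
open import Relation.Nullary.Decidable using (⌊_⌋)
open import Relation.Binary.PropositionalEquality using (_≡_; _≢_)

count : (n : ℕ) → (Fin n → Bool) → ℕ
count zero    f = 0
count (suc n) f with f zero
... | true  = suc (count n (λ i → f (suc i)))
... | false = count n (λ i → f (suc i))

anyFin : (n : ℕ) → (Fin n → Bool) → Bool
anyFin zero    f = false
anyFin (suc n) f = f zero ∨ anyFin n (λ i → f (suc i))

-- An affine plane of order q: q² points (Fin (q * q)), q² + q lines
-- (Fin (q * q + q)), incidence _∈ₗ_ (p ∈ₗ l = true iff point p lies on line l),
-- and a partition of the lines into q + 1 parallel classes (map `parClass`).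
record AffinePlane (q : ℕ) : Set where
  field
    _∈ₗ_ : Fin (q * q) → Fin (q * q + q) → Bool
    lineSize : ∀ l → count (q * q) (λ p → p ∈ₗ l) ≡ q
    twoPoints : ∀ p p' → p ≢ p' → count (q * q + q) (λ l → (p ∈ₗ l) ∧ (p' ∈ₗ l)) ≡ 1
    twoLines : ∀ l l' → l ≢ l' → count (q * q) (λ p → (p ∈ₗ l) ∧ (p ∈ₗ l')) ≤ 1
    parClass : Fin (q * q + q) → Fin (q + 1)
    classSize : ∀ c → count (q * q + q) (λ l → ⌊ parClass l ≟ c ⌋) ≡ q
    classDisjoint : ∀ l l' → l ≢ l' → parClass l ≡ parClass l' →
                    ∀ p → (p ∈ₗ l) ∧ (p ∈ₗ l') ≡ false

module _ {q : ℕ} (A : AffinePlane q) (L : Fin (q + 1) → Fin (q * q + q)) where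
  open AffinePlane A

  inKakeya : Fin (q * q) → Bool
  inKakeya p = anyFin (q + 1) (λ i → p ∈ₗ L i)

  kakeyaSize : ℕ
  kakeyaSize = count (q * q) inKakeya

  knotMult : Fin (q * q) → ℕ
  knotMult p = count (q + 1) (λ i → p ∈ₗ L i)

  IsKnot : ℕ → Fin (q * q) → Set
  IsKnot j p = knotMult p ≡ j

-- Let P be a point of maximal multiplicity M and k = q + 1 - M the number of lines of L missing P.
-- For a point p let a p and b p be the numbers of lines of L through p that pass through P and that
-- miss P. Two non-parallel lines meet exactly once, so the sums over all points of a, b, a², ab and
-- b² are determined by q, M and k; in particular a ≤ 1 away from P. Away from P the indicator of
-- p ∈ K lies between (2a + 3b - 2ab - b²)/2 and a + b - ab, and summing gives
-- q² - kq + k(k+1)/2 ≤ |K| ≤ q² - kq + k². It remains to see k ≤ √q. If M ≤ √q, then since every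
-- multiplicity is at most M, the identity Σ mult² = 2q(q+1) forces |K| ≤ (1 - 1/M)q(q+1), which is
-- too small; if both M and k exceed √q, the upper bound above contradicts |K| > q² - q√q + q.

module Submission where

open import Defs
open import Data.Nat using (ℕ; _+_; _*_; _∸_; _≤_; _<_; _/_)
open import Data.Fin using (Fin)
open import Data.Product using (Σ; _×_; ∃)
open import Relation.Binary.PropositionalEquality using (_≡_; _≢_)

open import Data.Bool using (Bool; true; false; if_then_else_; _∧_; not)
open import Data.Empty using (⊥; ⊥-elim)
open import Data.Fin using (zero; suc; punchIn; punchOut; _≟_; fromℕ<)
open import Data.Fin.Properties using (punchInᵢ≢i; punchIn-punchOut; suc-injective)
open import Data.List using (_∷_; [])
open import Data.Nat using (zero; suc; z≤n; s≤s; z<s; _⊓_; _≤?_)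
open import Data.Nat.DivMod using (m/n*n≤m)
open import Data.Nat.Properties hiding (_≟_; suc-injective)
import Data.Nat.Properties as ℕ
open import Data.Nat.Tactic.RingSolver using (solve-∀; solve)
open import Data.Product using (_,_; proj₁; proj₂)
open import Function using (_∘_)
open import Relation.Binary.PropositionalEquality
  using (refl; sym; trans; subst; subst₂; cong; cong₂; module ≡-Reasoning)
open import Relation.Nullary using (contradiction; yes; no)
open import Relation.Nullary.Decidable using (⌊_⌋)
open import Algebra.Properties.CommutativeSemigroup +-commutativeSemigroup
  using (xy∙z≈zy∙x; xy∙z≈zx∙y; xy∙z≈xz∙y)
open import Algebra.Properties.CommutativeSemigroup *-commutativeSemigroup
  using () renaming (x∙yz≈y∙xz to x*yz≡y*xz)
open import Algebra.Properties.Semiring.Sum +-*-semiring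
  using ( sum; sum-syntax; sum-cong-≗; sum-replicate-zero; sum-remove
        ; ∑-distrib-+; ∑-comm; *-distribˡ-sum; *-distribʳ-sum)

m≤m*m : ∀ m → m ≤ m * m
m≤m*m zero    = z≤n
m≤m*m (suc m) = m≤m*n (suc m) (suc m)

m≡m*m⇒m≤1 : ∀ m → m ≡ m * m → m ≤ 1
m≡m*m⇒m≤1 0             _ = z≤n
m≡m*m⇒m≤1 1             _ = ≤-refl
m≡m*m⇒m≤1 (suc (suc m)) m≡m*m = contradiction m≡m*m (<⇒≢ (m<m*n (2 + m) (2 + m) (s≤s (s≤s z≤n))))

1⊓[m+0]≡1 : ∀ {m} → 1 ≤ m → 1 ⊓ (m + 0) ≡ 1
1⊓[m+0]≡1 {suc m} _ = refl

1⊓[x+y]+x*y≤x+y : ∀ x y → x ≤ 1 → 1 ⊓ (x + y) + x * y ≤ x + y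
1⊓[x+y]+x*y≤x+y 0 0       _ = z≤n
1⊓[x+y]+x*y≤x+y 0 (suc y) _ = s≤s z≤n
1⊓[x+y]+x*y≤x+y 1 y       _ = ≤-reflexive (cong suc (+-identityʳ y))
1⊓[x+y]+x*y≤x+y (suc (suc x)) y (s≤s ())

2*x+3*y≤2*[1⊓[x+y]]+2*[x*y]+y*y : ∀ x y → x ≤ 1 → 2 * x + 3 * y ≤ 2 * (1 ⊓ (x + y)) + 2 * (x * y) + y * y
2*x+3*y≤2*[1⊓[x+y]]+2*[x*y]+y*y 0 0       _ = z≤n
2*x+3*y≤2*[1⊓[x+y]]+2*[x*y]+y*y 0 (suc y) _ = begin
  3 * suc y              ≡⟨ solve (y ∷ []) ⟩
  3 + 2 * y + y          ≤⟨ +-monoʳ-≤ (3 + 2 * y) (m≤m*m y) ⟩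
  3 + 2 * y + y * y      ≡⟨ solve (y ∷ []) ⟩
  2 + suc y * suc y      ∎
  where open ≤-Reasoning
2*x+3*y≤2*[1⊓[x+y]]+2*[x*y]+y*y 1 y       _ = begin
  2 + 3 * y              ≡⟨ solve (y ∷ []) ⟩
  2 + 2 * y + y          ≤⟨ +-monoʳ-≤ (2 + 2 * y) (m≤m*m y) ⟩
  2 + 2 * y + y * y      ≡⟨ solve (y ∷ []) ⟩
  2 * 1 + 2 * (1 * y) + y * y ∎
  where open ≤-Reasoning
2*x+3*y≤2*[1⊓[x+y]]+2*[x*y]+y*y (suc (suc x)) y (s≤s ())

m*m+n*[1⊓m]≤[n+1]*m : ∀ m n → m ≤ n → m * m + n * (1 ⊓ m) ≤ (n + 1) * m
m*m+n*[1⊓m]≤[n+1]*m 0       n _   = ≤-reflexive (trans (*-zeroʳ n) (sym (*-zeroʳ (n + 1))))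
m*m+n*[1⊓m]≤[n+1]*m (suc m) n m<n = begin
  suc m * suc m + n * 1      ≡⟨ solve (m ∷ n ∷ []) ⟩
  suc m + (m * suc m + n)    ≤⟨ +-monoʳ-≤ (suc m) (+-monoˡ-≤ n (*-monoʳ-≤ m m<n)) ⟩
  suc m + (m * n + n)        ≡⟨ solve (m ∷ n ∷ []) ⟩
  (n + 1) * suc m            ∎
  where open ≤-Reasoning

m+n≤o+p⇒m≤o∸n+p : ∀ {m n o p} → m + n ≤ o + p → n ≤ o → m ≤ o ∸ n + p
m+n≤o+p⇒m≤o∸n+p {m} {n} {o} {p} m+n≤o+p n≤o = +-cancelʳ-≤ n m (o ∸ n + p) (begin
  m + n              ≤⟨ m+n≤o+p ⟩
  o + p              ≡⟨ cong (_+ p) (m∸n+n≡m n≤o) ⟨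
  o ∸ n + n + p      ≡⟨ xy∙z≈xz∙y (o ∸ n) n p ⟩
  o ∸ n + p + n      ∎)
  where open ≤-Reasoning

m+n≤o+p⇒m∸p+n≤o : ∀ {m n o p} → m + n ≤ o + p → p ≤ m → m ∸ p + n ≤ o
m+n≤o+p⇒m∸p+n≤o {m} {n} {o} {p} m+n≤o+p p≤m = +-cancelʳ-≤ p (m ∸ p + n) o (begin
  m ∸ p + n + p      ≡⟨ xy∙z≈xz∙y (m ∸ p) n p ⟩
  m ∸ p + p + n      ≡⟨ cong (_+ n) (m∸n+n≡m p≤m) ⟩
  m + n              ≤⟨ m+n≤o+p ⟩
  o + p              ∎)
  where open ≤-Reasoning

2*m+n≤2*o⇒m+n/2≤o : ∀ m n o → 2 * m + n ≤ 2 * o → m + n / 2 ≤ o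
2*m+n≤2*o⇒m+n/2≤o m n o 2m+n≤2o = *-cancelˡ-≤ 2 (begin
  2 * (m + n / 2)        ≡⟨ *-distribˡ-+ 2 m (n / 2) ⟩
  2 * m + 2 * (n / 2)    ≡⟨ cong (2 * m +_) (*-comm 2 (n / 2)) ⟩
  2 * m + n / 2 * 2      ≤⟨ +-monoʳ-≤ (2 * m) (m/n*n≤m n 2) ⟩
  2 * m + n              ≤⟨ 2m+n≤2o ⟩
  2 * o                  ∎)
  where open ≤-Reasoning

m∸n+o<p⇒m+o+1≤p+n : ∀ {m n o p} → n ≤ m → m ∸ n + o < p → m + o + 1 ≤ p + n
m∸n+o<p⇒m+o+1≤p+n {m} {n} {o} {p} n≤m m∸n+o<p = begin
  m + o + 1              ≡⟨ +-comm (m + o) 1 ⟩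
  suc (m + o)            ≡⟨ cong (λ x → suc (x + o)) (m∸n+n≡m n≤m) ⟨
  suc (m ∸ n + n + o)    ≡⟨ cong suc (xy∙z≈xz∙y (m ∸ n) n o) ⟩
  suc (m ∸ n + o) + n    ≤⟨ +-monoˡ-≤ n m∸n+o<p ⟩
  p + n                  ∎
  where open ≤-Reasoning

1+m+k≡q+1⇒m+k≡q : ∀ {m k q} → suc m + k ≡ q + 1 → m + k ≡ q
1+m+k≡q+1⇒m+k≡q {q = q} e = ℕ.suc-injective (trans e (+-comm q 1))

knot-upper-arith : ∀ {q M k K} → 1 ≤ M → M + k ≡ q + 1 →
  K + M * k + M ≤ M * q + k * q + 1 → K + k * q ≤ q * q + k * k
knot-upper-arith {q} {suc m} {k} {K} _ M+k≡q+1 hyp with refl ← 1+m+k≡q+1⇒m+k≡q {m} {k} M+k≡q+1 =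
  +-cancelʳ-≤ (q + 1) (K + k * q) (q * q + k * k) (begin
    K + k * q + (q + 1)                    ≡⟨ solve (K ∷ m ∷ k ∷ []) ⟩
    K + suc m * k + suc m + k * k          ≤⟨ +-monoˡ-≤ (k * k) hyp ⟩
    suc m * q + k * q + 1 + k * k          ≡⟨ solve (m ∷ k ∷ []) ⟩
    q * q + k * k + (q + 1)                ∎)
  where open ≤-Reasoning

knot-lower-arith : ∀ {q M k K} → 1 ≤ M → M + k ≡ q + 1 →
  2 * (M * q) + 3 * (k * q) + 2 + k ≤ 2 * K + 2 * (M * k) + (k * k + q * k) + 2 * M →
  2 * (q * q) + k * (k + 1) ≤ 2 * K + 2 * (k * q)
knot-lower-arith {q} {suc m} {k} {K} _ M+k≡q+1 hyp with refl ← 1+m+k≡q+1⇒m+k≡q {m} {k} M+k≡q+1 =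
  +-cancelʳ-≤ (m * k + 2 * k + 2 * m + 2) (2 * (q * q) + k * (k + 1)) (2 * K + 2 * (k * q)) (begin
    2 * (q * q) + k * (k + 1) + (m * k + 2 * k + 2 * m + 2)           ≡⟨ solve (m ∷ k ∷ []) ⟩
    2 * (suc m * q) + 3 * (k * q) + 2 + k                              ≤⟨ hyp ⟩
    2 * K + 2 * (suc m * k) + (k * k + q * k) + 2 * suc m              ≡⟨ solve (K ∷ m ∷ k ∷ []) ⟩
    2 * K + 2 * (k * q) + (m * k + 2 * k + 2 * m + 2)                 ∎)
  where open ≤-Reasoning

knot-mid-arith : ∀ {s q M k K} → q ≡ s * s → M + k ≡ q + 1 → s < k → s < M →
  K + k * q ≤ q * q + k * k → q * q + q + 1 ≤ K + q * s → ⊥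
knot-mid-arith {s} {q} {M} {k} {K} q≡s² M+k≡q+1 s<k s<M upper large
  with β , refl ← m≤n⇒∃[o]m+o≡n s<k
     | α , refl ← m≤n⇒∃[o]m+o≡n s<M
  with refl ← 1+m+k≡q+1⇒m+k≡q {s + α} {k} M+k≡q+1 = <-irrefl refl (begin-strict
    k * k + q * s                            <⟨ s≤s (m≤m+n (k * k + q * s) (α + α * β)) ⟩
    suc (k * k + q * s + (α + α * β))        ≡⟨ solve (s ∷ α ∷ β ∷ []) ⟩
    k * k + (s * q + α + α * β) + 1          ≡⟨ cong (λ x → k * k + x + 1) key ⟨
    k * k + (k * (s + α) + q) + 1            ≡⟨ solve (s ∷ α ∷ β ∷ []) ⟩
    q + 1 + k * q                            ≤⟨ gap ⟩
    k * k + q * s                            ∎)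
  where
  open ≤-Reasoning
  -- With k = s + 1 + β and M = s + 1 + α, this is k (M - 1) + q = s q + α + α β; the identity
  -- holds modulo q = s², which is used exactly once.
  key : k * (s + α) + q ≡ s * q + α + α * β
  key = +-cancelʳ-≡ (s * s) _ _ (begin-equality
    k * (s + α) + q + s * s                  ≡⟨ solve (s ∷ α ∷ β ∷ []) ⟩
    s * q + α + α * β + q                    ≡⟨ cong (s * q + α + α * β +_) q≡s² ⟩
    s * q + α + α * β + s * s                ∎)
  gap : q + 1 + k * q ≤ k * k + q * s
  gap = +-cancelˡ-≤ (K + q * q) _ _ (begin
    K + q * q + (q + 1 + k * q)              ≡⟨ solve (K ∷ s ∷ α ∷ β ∷ []) ⟩
    (q * q + q + 1) + (K + k * q)            ≤⟨ +-mono-≤ large upper ⟩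
    (K + q * s) + (q * q + k * k)            ≡⟨ solve (K ∷ s ∷ α ∷ β ∷ []) ⟩
    K + q * q + (k * k + q * s)              ∎)

knot-small-arith : ∀ {s q M K} → q ≡ s * s → 1 ≤ q → M ≤ s →
  (q + 1) * q + M * K ≤ M * ((q + 1) * q) → q * q + q + 1 ≤ K + q * s → ⊥
knot-small-arith {s} {q} {M} {K} q≡s² 1≤q M≤s maximal large = <-irrefl refl (begin-strict
  q * q                    <⟨ m<m+n (q * q) 1≤q ⟩
  q * q + q                ≤⟨ m≤m+n (q * q + q) M ⟩
  q * q + q + M            ≡⟨ solve (q ∷ M ∷ []) ⟩
  (q + 1) * q + M          ≤⟨ +-cancelˡ-≤ (M * ((q + 1) * q)) _ _ step ⟩
  M * (q * s)              ≤⟨ *-monoˡ-≤ (q * s) M≤s ⟩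
  s * (q * s)              ≡⟨ solve (s ∷ q ∷ []) ⟩
  q * (s * s)              ≡⟨ cong (q *_) q≡s² ⟨
  q * q                    ∎)
  where
  open ≤-Reasoning
  step : M * ((q + 1) * q) + ((q + 1) * q + M) ≤ M * ((q + 1) * q) + M * (q * s)
  step = begin
    M * ((q + 1) * q) + ((q + 1) * q + M)   ≡⟨ solve (q ∷ M ∷ []) ⟩
    (q + 1) * q + M * (q * q + q + 1)       ≤⟨ +-monoʳ-≤ ((q + 1) * q) (*-monoʳ-≤ M large) ⟩
    (q + 1) * q + M * (K + q * s)           ≡⟨ solve (q ∷ M ∷ K ∷ s ∷ []) ⟩
    (q + 1) * q + M * K + M * (q * s)       ≤⟨ +-monoˡ-≤ (M * (q * s)) maximal ⟩
    M * ((q + 1) * q) + M * (q * s)         ∎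

∑-const : ∀ n c → ∑[ i < n ] c ≡ n * c
∑-const zero    c = refl
∑-const (suc n) c = cong (c +_) (∑-const n c)

∑-mono-≤ : ∀ {n} {f g : Fin n → ℕ} → (∀ i → f i ≤ g i) → sum f ≤ sum g
∑-mono-≤ {zero}  f≤g = z≤n
∑-mono-≤ {suc n} f≤g = +-mono-≤ (f≤g zero) (∑-mono-≤ (λ i → f≤g (suc i)))

∑-mono-≤-rigid : ∀ {n} {f g : Fin n → ℕ} → (∀ i → f i ≤ g i) → sum g ≤ sum f → ∀ i → f i ≡ g i
∑-mono-≤-rigid {suc n} {f} {g} f≤g ∑g≤∑f = go
  where
  tail≤ : sum (λ i → f (suc i)) ≤ sum (λ i → g (suc i))
  tail≤ = ∑-mono-≤ (λ i → f≤g (suc i))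
  tail≥ : sum (λ i → g (suc i)) ≤ sum (λ i → f (suc i))
  tail≥ = +-cancelˡ-≤ (g zero) _ _ (≤-trans ∑g≤∑f (+-monoˡ-≤ _ (f≤g zero)))
  head≥ : g zero ≤ f zero
  head≥ = +-cancelʳ-≤ _ _ _ (≤-trans (+-monoʳ-≤ (g zero) tail≤) ∑g≤∑f)
  go : ∀ i → f i ≡ g i
  go zero    = ≤-antisym (f≤g zero) head≥
  go (suc i) = ∑-mono-≤-rigid (λ j → f≤g (suc j)) tail≥ i

∑-mono-≤-except : ∀ {n} {f g : Fin n → ℕ} i → (∀ j → j ≢ i → f j ≤ g j) →
                  sum f + g i ≤ sum g + f i
∑-mono-≤-except {suc n} {f} {g} i f≤g = begin
  sum f + g i                      ≡⟨ cong (_+ g i) (sum-remove {i = i} f) ⟩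
  f i + sum (f ∘ punchIn i) + g i  ≡⟨ xy∙z≈zy∙x (f i) _ (g i) ⟩
  g i + sum (f ∘ punchIn i) + f i  ≤⟨ +-monoˡ-≤ (f i) (+-monoʳ-≤ (g i) rest≤) ⟩
  g i + sum (g ∘ punchIn i) + f i  ≡⟨ cong (_+ f i) (sum-remove {i = i} g) ⟨
  sum g + f i                      ∎
  where
  open ≤-Reasoning
  rest≤ : sum (f ∘ punchIn i) ≤ sum (g ∘ punchIn i)
  rest≤ = ∑-mono-≤ (λ j → f≤g (punchIn i j) (punchInᵢ≢i i j))

∑-mono-≤-except-rigid : ∀ {n} {f g : Fin n → ℕ} i → (∀ j → j ≢ i → f j ≤ g j) →
                        sum g + f i ≤ sum f + g i → ∀ j → j ≢ i → f j ≡ g j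
∑-mono-≤-except-rigid {suc n} {f} {g} i f≤g ∑g≤∑f j j≢i =
  subst (λ k → f k ≡ g k) (punchIn-punchOut i≢j) (∑-mono-≤-rigid rest≤ rest≥ (punchOut i≢j))
  where
  open ≤-Reasoning
  i≢j = λ i≡j → j≢i (sym i≡j)
  rest≤ : ∀ j → f (punchIn i j) ≤ g (punchIn i j)
  rest≤ j = f≤g (punchIn i j) (punchInᵢ≢i i j)
  rest≥ : sum (g ∘ punchIn i) ≤ sum (f ∘ punchIn i)
  rest≥ = +-cancelˡ-≤ (f i + g i) _ _ (begin
    f i + g i + sum (g ∘ punchIn i)  ≡⟨ xy∙z≈zx∙y (g i) _ (f i) ⟨
    g i + sum (g ∘ punchIn i) + f i  ≡⟨ cong (_+ f i) (sum-remove {i = i} g) ⟨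
    sum g + f i                      ≤⟨ ∑g≤∑f ⟩
    sum f + g i                      ≡⟨ cong (_+ g i) (sum-remove {i = i} f) ⟩
    f i + sum (f ∘ punchIn i) + g i  ≡⟨ xy∙z≈xz∙y (f i) _ (g i) ⟩
    f i + g i + sum (f ∘ punchIn i)  ∎)

∑-cong-except : ∀ {n} {f g : Fin n → ℕ} i → (∀ j → j ≢ i → f j ≡ g j) →
                sum f + g i ≡ sum g + f i
∑-cong-except i f≡g = ≤-antisym
  (∑-mono-≤-except i (λ j j≢i → ≤-reflexive (f≡g j j≢i)))
  (∑-mono-≤-except i (λ j j≢i → ≤-reflexive (sym (f≡g j j≢i))))

-- The first argument only witnesses that Fin n is inhabited.
argmax : ∀ {n} → Fin n → (f : Fin n → ℕ) → ∃ λ i → ∀ j → f j ≤ f i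
argmax {suc zero}    _ f = zero , λ { zero → ≤-refl }
argmax {suc (suc n)} _ f with argmax zero (f ∘ suc)
... | i , f∘suc≤ with f zero ≤? f (suc i)
...   | yes f0≤ = suc i , λ { zero → f0≤ ; (suc j) → f∘suc≤ j }
...   | no  f0≰ = zero  , λ { zero → ≤-refl ; (suc j) → ≤-trans (f∘suc≤ j) (≰⇒≥ f0≰) }

[_] : Bool → ℕ
[ b ] = if b then 1 else 0

[b]*[b]≡[b] : ∀ b → [ b ] * [ b ] ≡ [ b ]
[b]*[b]≡[b] true  = refl
[b]*[b]≡[b] false = refl

[b]+[not-b]≡1 : ∀ b → [ b ] + [ not b ] ≡ 1
[b]+[not-b]≡1 true  = refl
[b]+[not-b]≡1 false = refl

[b]*[not-b]≡0 : ∀ b → [ b ] * [ not b ] ≡ 0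
[b]*[not-b]≡0 true  = refl
[b]*[not-b]≡0 false = refl

[∧]≡* : ∀ a b → [ a ∧ b ] ≡ [ a ] * [ b ]
[∧]≡* true  b = sym (+-identityʳ [ b ])
[∧]≡* false b = refl

∧≡true : ∀ {a b} → a ∧ b ≡ true → a ≡ true × b ≡ true
∧≡true {true} {true} _ = refl , refl

count≡∑ : ∀ n (f : Fin n → Bool) → count n f ≡ ∑[ i < n ] [ f i ]
count≡∑ zero    f = refl
count≡∑ (suc n) f with f zero
... | true  = cong suc (count≡∑ n (f ∘ suc))
... | false = count≡∑ n (f ∘ suc)

[anyFin]≡1⊓count : ∀ n (f : Fin n → Bool) → [ anyFin n f ] ≡ 1 ⊓ count n f
[anyFin]≡1⊓count zero    f = refl
[anyFin]≡1⊓count (suc n) f with f zero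
... | true  = refl
... | false = [anyFin]≡1⊓count n (f ∘ suc)

count≡0 : ∀ n (f : Fin n → Bool) → (∀ i → f i ≡ false) → count n f ≡ 0
count≡0 zero    f f≡false = refl
count≡0 (suc n) f f≡false with f zero | f≡false zero
... | false | _ = count≡0 n (f ∘ suc) (f≡false ∘ suc)

count≤1 : ∀ n (f : Fin n → Bool) → (∀ i j → f i ≡ true → f j ≡ true → i ≡ j) → count n f ≤ 1
count≤1 zero    f unique = z≤n
count≤1 (suc n) f unique with f zero in f0
... | true  = ≤-reflexive (cong suc (count≡0 n (f ∘ suc) rest))
  where
  rest : ∀ i → f (suc i) ≡ false
  rest i with f (suc i) in fi
  ... | false = refl
  ... | true  = contradiction (unique zero (suc i) f0 fi) λ ()
... | false = count≤1 n (f ∘ suc) λ i j fi fj → suc-injective (unique (suc i) (suc j) fi fj)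

module AffinePlaneCounting {q : ℕ} (A : AffinePlane q) where
  open AffinePlane A

  inClass : Fin (q + 1) → Fin (q * q + q) → Bool
  inClass c l = ⌊ parClass l ≟ c ⌋

  inClass-parClass : ∀ l → inClass (parClass l) l ≡ true
  inClass-parClass l with parClass l ≟ parClass l
  ... | yes _ = refl
  ... | no ≢  = contradiction refl ≢

  inClass⇒≡ : ∀ {c l} → inClass c l ≡ true → parClass l ≡ c
  inClass⇒≡ {c} {l} h with parClass l ≟ c
  ... | yes parClass≡c = parClass≡c

  meet : Fin (q * q + q) → Fin (q * q + q) → ℕ
  meet l l' = ∑[ p < q * q ] ([ p ∈ₗ l ] * [ p ∈ₗ l' ])

  ∑-line : ∀ l → ∑[ p < q * q ] [ p ∈ₗ l ] ≡ q
  ∑-line l = trans (sym (count≡∑ (q * q) (_∈ₗ l))) (lineSize l)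

  ∑-class : ∀ c → ∑[ l < q * q + q ] [ inClass c l ] ≡ q
  ∑-class c = trans (sym (count≡∑ (q * q + q) (inClass c))) (classSize c)

  meet-self : ∀ l → meet l l ≡ q
  meet-self l = trans (sum-cong-≗ (λ p → [b]*[b]≡[b] (p ∈ₗ l))) (∑-line l)

  meet≤1 : ∀ l l' → l ≢ l' → meet l l' ≤ 1
  meet≤1 l l' l≢l' = begin
    meet l l'                                          ≡⟨ sum-cong-≗ (λ p → [∧]≡* (p ∈ₗ l) (p ∈ₗ l')) ⟨
    ∑[ p < q * q ] [ p ∈ₗ l ∧ p ∈ₗ l' ]                ≡⟨ count≡∑ (q * q) _ ⟨
    count (q * q) (λ p → (p ∈ₗ l) ∧ (p ∈ₗ l'))          ≤⟨ twoLines l l' l≢l' ⟩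
    1                                                  ∎
    where open ≤-Reasoning

  linesOfClassThrough : Fin (q + 1) → Fin (q * q) → ℕ
  linesOfClassThrough c p = ∑[ l < q * q + q ] ([ inClass c l ] * [ p ∈ₗ l ])

  linesOfClassThrough≤1 : ∀ c p → linesOfClassThrough c p ≤ 1
  linesOfClassThrough≤1 c p = begin
    linesOfClassThrough c p                          ≡⟨ sum-cong-≗ (λ l → [∧]≡* (inClass c l) (p ∈ₗ l)) ⟨
    ∑[ l < q * q + q ] [ inClass c l ∧ p ∈ₗ l ]      ≡⟨ count≡∑ (q * q + q) _ ⟨
    count (q * q + q) (λ l → inClass c l ∧ p ∈ₗ l)   ≤⟨ count≤1 (q * q + q) _ unique ⟩
    1                                                ∎
    where
    open ≤-Reasoning
    unique : ∀ l l' → inClass c l ∧ p ∈ₗ l ≡ true → inClass c l' ∧ p ∈ₗ l' ≡ true → l ≡ l'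
    unique l l' hl hl' with l ≟ l' | ∧≡true hl | ∧≡true hl'
    ... | yes l≡l' | _ | _ = l≡l'
    ... | no l≢l'  | cl , pl | cl' , pl' = contradiction
      (trans (sym (classDisjoint l l' l≢l' sameClass p)) (cong₂ _∧_ pl pl')) λ ()
      where sameClass = trans (inClass⇒≡ cl) (sym (inClass⇒≡ cl'))

  ∑-linesOfClassThrough : ∀ c → ∑[ p < q * q ] linesOfClassThrough c p ≡ q * q
  ∑-linesOfClassThrough c = begin
    ∑[ p < q * q ] ∑[ l < q * q + q ] ([ inClass c l ] * [ p ∈ₗ l ])
      ≡⟨ ∑-comm (λ p l → [ inClass c l ] * [ p ∈ₗ l ]) ⟩
    ∑[ l < q * q + q ] ∑[ p < q * q ] ([ inClass c l ] * [ p ∈ₗ l ])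
      ≡⟨ sum-cong-≗ (λ l → *-distribˡ-sum [ inClass c l ] (λ p → [ p ∈ₗ l ])) ⟨
    ∑[ l < q * q + q ] ([ inClass c l ] * ∑[ p < q * q ] [ p ∈ₗ l ])
      ≡⟨ sum-cong-≗ (λ l → cong ([ inClass c l ] *_) (∑-line l)) ⟩
    ∑[ l < q * q + q ] ([ inClass c l ] * q)
      ≡⟨ *-distribʳ-sum q (λ l → [ inClass c l ]) ⟨
    ∑[ l < q * q + q ] [ inClass c l ] * q
      ≡⟨ cong (_* q) (∑-class c) ⟩
    q * q
      ∎
    where open ≡-Reasoning

  -- The q pairwise disjoint lines of a class have q points each, so they cover all q² points.
  linesOfClassThrough≡1 : ∀ c p → linesOfClassThrough c p ≡ 1
  linesOfClassThrough≡1 c = ∑-mono-≤-rigid (linesOfClassThrough≤1 c) (≤-reflexive (begin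
    ∑[ p < q * q ] 1                       ≡⟨ ∑-const (q * q) 1 ⟩
    q * q * 1                              ≡⟨ *-identityʳ (q * q) ⟩
    q * q                                  ≡⟨ ∑-linesOfClassThrough c ⟨
    ∑[ p < q * q ] linesOfClassThrough c p ∎))
    where open ≡-Reasoning

  -- Each of the q points of l lies on exactly one of the q lines of the class of l', and each of
  -- those lines meets l at most once.
  meet≡1 : ∀ l l' → parClass l ≢ parClass l' → meet l l' ≡ 1
  meet≡1 l l' l∦l' = begin
    meet l l'                            ≡⟨ +-identityʳ (meet l l') ⟨
    1 * meet l l'                        ≡⟨ cong (λ b → [ b ] * meet l l') (inClass-parClass l') ⟨
    [ inClass c l' ] * meet l l'         ≡⟨ ∑-mono-≤-rigid f≤g (≤-reflexive (trans (∑-class c) (sym ∑f≡q))) l' ⟩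
    [ inClass c l' ]                     ≡⟨ cong [_] (inClass-parClass l') ⟩
    1                                    ∎
    where
    open ≡-Reasoning
    c = parClass l'
    f≤g : ∀ l'' → [ inClass c l'' ] * meet l l'' ≤ [ inClass c l'' ]
    f≤g l'' with inClass c l'' in l''∈c
    ... | false = z≤n
    ... | true  = ≤-trans (≤-reflexive (+-identityʳ (meet l l''))) (meet≤1 l l'' l≢l'')
      where l≢l'' = λ l≡l'' → l∦l' (trans (cong parClass l≡l'') (inClass⇒≡ l''∈c))
    ∑f≡q : ∑[ l'' < q * q + q ] ([ inClass c l'' ] * meet l l'') ≡ q
    ∑f≡q = begin
      ∑[ l'' < q * q + q ] ([ inClass c l'' ] * meet l l'')
        ≡⟨ sum-cong-≗ (λ l'' → *-distribˡ-sum [ inClass c l'' ] (λ p → [ p ∈ₗ l ] * [ p ∈ₗ l'' ])) ⟩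
      ∑[ l'' < q * q + q ] ∑[ p < q * q ] ([ inClass c l'' ] * ([ p ∈ₗ l ] * [ p ∈ₗ l'' ]))
        ≡⟨ ∑-comm (λ l'' p → [ inClass c l'' ] * ([ p ∈ₗ l ] * [ p ∈ₗ l'' ])) ⟩
      ∑[ p < q * q ] ∑[ l'' < q * q + q ] ([ inClass c l'' ] * ([ p ∈ₗ l ] * [ p ∈ₗ l'' ]))
        ≡⟨ sum-cong-≗ (λ p → sum-cong-≗ (λ l'' → x*yz≡y*xz [ inClass c l'' ] [ p ∈ₗ l ] [ p ∈ₗ l'' ])) ⟩
      ∑[ p < q * q ] ∑[ l'' < q * q + q ] ([ p ∈ₗ l ] * ([ inClass c l'' ] * [ p ∈ₗ l'' ]))
        ≡⟨ sum-cong-≗ (λ p → *-distribˡ-sum [ p ∈ₗ l ] (λ l'' → [ inClass c l'' ] * [ p ∈ₗ l'' ])) ⟨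
      ∑[ p < q * q ] ([ p ∈ₗ l ] * linesOfClassThrough c p)
        ≡⟨ sum-cong-≗ (λ p → trans (cong ([ p ∈ₗ l ] *_) (linesOfClassThrough≡1 c p)) (*-identityʳ [ p ∈ₗ l ])) ⟩
      ∑[ p < q * q ] [ p ∈ₗ l ]
        ≡⟨ ∑-line l ⟩
      q ∎

module KakeyaCounting {q : ℕ} (A : AffinePlane q) (L : Fin (q + 1) → Fin (q * q + q))
  (L-nonParallel : ∀ i j → i ≢ j → AffinePlane.parClass A (L i) ≢ AffinePlane.parClass A (L j)) where
  open AffinePlane A
  open AffinePlaneCounting A

  incidence : Fin (q + 1) → Fin (q * q) → ℕ
  incidence i p = [ p ∈ₗ L i ]

  ∑-meetL : ∀ (y : Fin (q + 1) → ℕ) i →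
            ∑[ j < q + 1 ] (y j * meet (L i) (L j)) + y i ≡ ∑[ j < q + 1 ] y j + q * y i
  ∑-meetL y i = begin
    ∑[ j < q + 1 ] (y j * meet (L i) (L j)) + y i  ≡⟨ ∑-cong-except i off-diagonal ⟩
    ∑[ j < q + 1 ] y j + y i * meet (L i) (L i)    ≡⟨ cong (λ m → ∑[ j < q + 1 ] y j + y i * m) (meet-self (L i)) ⟩
    ∑[ j < q + 1 ] y j + y i * q                   ≡⟨ cong (∑[ j < q + 1 ] y j +_) (*-comm (y i) q) ⟩
    ∑[ j < q + 1 ] y j + q * y i                   ∎
    where
    open ≡-Reasoning
    off-diagonal : ∀ j → j ≢ i → y j * meet (L i) (L j) ≡ y j
    off-diagonal j j≢i = trans (cong (y j *_) (meet≡1 (L i) (L j) (L-nonParallel i j (λ i≡j → j≢i (sym i≡j)))))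
                               (*-identityʳ (y j))

  weight : (Fin (q + 1) → ℕ) → Fin (q * q) → ℕ
  weight x p = ∑[ i < q + 1 ] (x i * incidence i p)

  ∑-weight : ∀ x → ∑[ p < q * q ] weight x p ≡ ∑[ i < q + 1 ] x i * q
  ∑-weight x = begin
    ∑[ p < q * q ] ∑[ i < q + 1 ] (x i * incidence i p)  ≡⟨ ∑-comm (λ p i → x i * incidence i p) ⟩
    ∑[ i < q + 1 ] ∑[ p < q * q ] (x i * incidence i p)  ≡⟨ sum-cong-≗ (λ i → *-distribˡ-sum (x i) (incidence i)) ⟨
    ∑[ i < q + 1 ] (x i * ∑[ p < q * q ] incidence i p)  ≡⟨ sum-cong-≗ (λ i → cong (x i *_) (∑-line (L i))) ⟩
    ∑[ i < q + 1 ] (x i * q)                             ≡⟨ *-distribʳ-sum q x ⟨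
    ∑[ i < q + 1 ] x i * q                               ∎
    where open ≡-Reasoning

  ∑-weight*weight : ∀ x y → ∑[ p < q * q ] (weight x p * weight y p)
                          ≡ ∑[ i < q + 1 ] (x i * ∑[ j < q + 1 ] (y j * meet (L i) (L j)))
  ∑-weight*weight x y = begin
    ∑[ p < q * q ] (weight x p * weight y p)
      ≡⟨ sum-cong-≗ (λ p → *-distribʳ-sum (weight y p) (λ i → x i * incidence i p)) ⟩
    ∑[ p < q * q ] ∑[ i < q + 1 ] (x i * incidence i p * weight y p)
      ≡⟨ ∑-comm (λ p i → x i * incidence i p * weight y p) ⟩
    ∑[ i < q + 1 ] ∑[ p < q * q ] (x i * incidence i p * weight y p)
      ≡⟨ sum-cong-≗ (λ i → sum-cong-≗ (λ p → *-distribˡ-sum (x i * incidence i p) (λ j → y j * incidence j p))) ⟩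
    ∑[ i < q + 1 ] ∑[ p < q * q ] ∑[ j < q + 1 ] (x i * incidence i p * (y j * incidence j p))
      ≡⟨ sum-cong-≗ (λ i → ∑-comm (λ p j → x i * incidence i p * (y j * incidence j p))) ⟩
    ∑[ i < q + 1 ] ∑[ j < q + 1 ] ∑[ p < q * q ] (x i * incidence i p * (y j * incidence j p))
      ≡⟨ sum-cong-≗ (λ i → sum-cong-≗ (λ j → sum-cong-≗ (λ p →
           xa*yb≡x*[y*[a*b]] (x i) (incidence i p) (y j) (incidence j p)))) ⟩
    ∑[ i < q + 1 ] ∑[ j < q + 1 ] ∑[ p < q * q ] (x i * (y j * (incidence i p * incidence j p)))
      ≡⟨ sum-cong-≗ (λ i → sum-cong-≗ (λ j → trans
           (cong (x i *_) (*-distribˡ-sum (y j) (λ p → incidence i p * incidence j p)))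
           (*-distribˡ-sum (x i) (λ p → y j * (incidence i p * incidence j p))))) ⟨
    ∑[ i < q + 1 ] ∑[ j < q + 1 ] (x i * (y j * meet (L i) (L j)))
      ≡⟨ sum-cong-≗ (λ i → *-distribˡ-sum (x i) (λ j → y j * meet (L i) (L j))) ⟨
    ∑[ i < q + 1 ] (x i * ∑[ j < q + 1 ] (y j * meet (L i) (L j)))
      ∎
    where
    open ≡-Reasoning
    xa*yb≡x*[y*[a*b]] : ∀ x a y b → x * a * (y * b) ≡ x * (y * (a * b))
    xa*yb≡x*[y*[a*b]] = solve-∀

  ∑-weight*weight+∑ : ∀ x y →
    ∑[ p < q * q ] (weight x p * weight y p) + ∑[ i < q + 1 ] (x i * y i)
      ≡ ∑[ i < q + 1 ] x i * ∑[ i < q + 1 ] y i + q * ∑[ i < q + 1 ] (x i * y i)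
  ∑-weight*weight+∑ x y = begin
    ∑[ p < q * q ] (weight x p * weight y p) + ∑[ i < q + 1 ] (x i * y i)
      ≡⟨ cong (_+ ∑[ i < q + 1 ] (x i * y i)) (∑-weight*weight x y) ⟩
    ∑[ i < q + 1 ] (x i * rowSum i) + ∑[ i < q + 1 ] (x i * y i)
      ≡⟨ ∑-distrib-+ (λ i → x i * rowSum i) (λ i → x i * y i) ⟨
    ∑[ i < q + 1 ] (x i * rowSum i + x i * y i)
      ≡⟨ sum-cong-≗ (λ i → trans (sym (*-distribˡ-+ (x i) (rowSum i) (y i))) (cong (x i *_) (∑-meetL y i))) ⟩
    ∑[ i < q + 1 ] (x i * (Σy + q * y i))
      ≡⟨ sum-cong-≗ (λ i → x*[s+qy]≡x*s+q*[x*y] (x i) Σy q (y i)) ⟩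
    ∑[ i < q + 1 ] (x i * Σy + q * (x i * y i))
      ≡⟨ ∑-distrib-+ (λ i → x i * Σy) (λ i → q * (x i * y i)) ⟩
    ∑[ i < q + 1 ] (x i * Σy) + ∑[ i < q + 1 ] (q * (x i * y i))
      ≡⟨ cong₂ _+_ (*-distribʳ-sum Σy x) (*-distribˡ-sum q (λ i → x i * y i)) ⟨
    ∑[ i < q + 1 ] x i * Σy + q * ∑[ i < q + 1 ] (x i * y i)
      ∎
    where
    open ≡-Reasoning
    Σy = ∑[ i < q + 1 ] y i
    rowSum : Fin (q + 1) → ℕ
    rowSum i = ∑[ j < q + 1 ] (y j * meet (L i) (L j))
    x*[s+qy]≡x*s+q*[x*y] : ∀ x s q y → x * (s + q * y) ≡ x * s + q * (x * y)
    x*[s+qy]≡x*s+q*[x*y] = solve-∀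

  ∑-indicator : (Fin (q + 1) → Bool) → ℕ
  ∑-indicator f = ∑[ i < q + 1 ] [ f i ]

  ∑-weight[]² : ∀ f → ∑[ p < q * q ] (weight ([_] ∘ f) p * weight ([_] ∘ f) p) + ∑-indicator f
                   ≡ ∑-indicator f * ∑-indicator f + q * ∑-indicator f
  ∑-weight[]² f = begin
    ∑[ p < q * q ] (weight ([_] ∘ f) p * weight ([_] ∘ f) p) + ∑-indicator f
      ≡⟨ cong (∑[ p < q * q ] (weight ([_] ∘ f) p * weight ([_] ∘ f) p) +_) ∑[]²≡∑[] ⟨
    ∑[ p < q * q ] (weight ([_] ∘ f) p * weight ([_] ∘ f) p) + ∑[ i < q + 1 ] ([ f i ] * [ f i ])
      ≡⟨ ∑-weight*weight+∑ ([_] ∘ f) ([_] ∘ f) ⟩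
    ∑-indicator f * ∑-indicator f + q * ∑[ i < q + 1 ] ([ f i ] * [ f i ])
      ≡⟨ cong (λ s → ∑-indicator f * ∑-indicator f + q * s) ∑[]²≡∑[] ⟩
    ∑-indicator f * ∑-indicator f + q * ∑-indicator f
      ∎
    where
    open ≡-Reasoning
    ∑[]²≡∑[] : ∑[ i < q + 1 ] ([ f i ] * [ f i ]) ≡ ∑-indicator f
    ∑[]²≡∑[] = sum-cong-≗ (λ i → [b]*[b]≡[b] (f i))

  mult : Fin (q * q) → ℕ
  mult = knotMult A L

  mult≡weight : ∀ p → mult p ≡ weight (λ _ → 1) p
  mult≡weight p = trans (count≡∑ (q + 1) (λ i → p ∈ₗ L i)) (sum-cong-≗ (λ i → sym (+-identityʳ (incidence i p))))

  kakeyaSize≡∑ : kakeyaSize A L ≡ ∑[ p < q * q ] (1 ⊓ mult p)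
  kakeyaSize≡∑ = trans (count≡∑ (q * q) (inKakeya A L))
                       (sum-cong-≗ (λ p → [anyFin]≡1⊓count (q + 1) (λ i → p ∈ₗ L i)))

  ∑-mult : ∑[ p < q * q ] mult p ≡ (q + 1) * q
  ∑-mult = begin
    ∑[ p < q * q ] mult p                ≡⟨ sum-cong-≗ mult≡weight ⟩
    ∑[ p < q * q ] weight (λ _ → 1) p    ≡⟨ ∑-weight (λ _ → 1) ⟩
    ∑[ i < q + 1 ] 1 * q                 ≡⟨ cong (_* q) (trans (∑-const (q + 1) 1) (*-identityʳ (q + 1))) ⟩
    (q + 1) * q                          ∎
    where open ≡-Reasoning

  ∑-mult² : ∑[ p < q * q ] (mult p * mult p) ≡ (q + 1) * q + (q + 1) * q
  ∑-mult² = +-cancelʳ-≡ (q + 1) _ _ (begin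
    ∑[ p < q * q ] (mult p * mult p) + (q + 1)
      ≡⟨ cong₂ _+_ (sum-cong-≗ (λ p → cong₂ _*_ (mult≡weight p) (mult≡weight p))) (sym ∑1≡q+1) ⟩
    ∑[ p < q * q ] (weight (λ _ → 1) p * weight (λ _ → 1) p) + ∑-indicator (λ _ → true)
      ≡⟨ ∑-weight[]² (λ _ → true) ⟩
    ∑-indicator (λ _ → true) * ∑-indicator (λ _ → true) + q * ∑-indicator (λ _ → true)
      ≡⟨ cong (λ s → s * s + q * s) ∑1≡q+1 ⟩
    (q + 1) * (q + 1) + q * (q + 1)
      ≡⟨ solve (q ∷ []) ⟩
    (q + 1) * q + (q + 1) * q + (q + 1)
      ∎)
    where
    open ≡-Reasoning
    ∑1≡q+1 : ∑-indicator (λ _ → true) ≡ q + 1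
    ∑1≡q+1 = trans (∑-const (q + 1) 1) (*-identityʳ (q + 1))

  maxKnot-bound : ∀ P → (∀ p → mult p ≤ mult P) →
                  (q + 1) * q + mult P * kakeyaSize A L ≤ mult P * ((q + 1) * q)
  maxKnot-bound P maximal = +-cancelˡ-≤ ((q + 1) * q) _ _ (begin
    (q + 1) * q + ((q + 1) * q + mult P * kakeyaSize A L)
      ≡⟨ +-assoc ((q + 1) * q) ((q + 1) * q) _ ⟨
    (q + 1) * q + (q + 1) * q + mult P * kakeyaSize A L
      ≡⟨ cong₂ (λ S K → S + mult P * K) ∑-mult² (sym kakeyaSize≡∑) ⟨
    ∑[ p < q * q ] (mult p * mult p) + mult P * ∑[ p < q * q ] (1 ⊓ mult p)
      ≡⟨ cong (∑[ p < q * q ] (mult p * mult p) +_) (*-distribˡ-sum (mult P) (λ p → 1 ⊓ mult p)) ⟩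
    ∑[ p < q * q ] (mult p * mult p) + ∑[ p < q * q ] (mult P * (1 ⊓ mult p))
      ≡⟨ ∑-distrib-+ (λ p → mult p * mult p) (λ p → mult P * (1 ⊓ mult p)) ⟨
    ∑[ p < q * q ] (mult p * mult p + mult P * (1 ⊓ mult p))
      ≤⟨ ∑-mono-≤ (λ p → m*m+n*[1⊓m]≤[n+1]*m (mult p) (mult P) (maximal p)) ⟩
    ∑[ p < q * q ] ((mult P + 1) * mult p)
      ≡⟨ *-distribˡ-sum (mult P + 1) mult ⟨
    (mult P + 1) * ∑[ p < q * q ] mult p
      ≡⟨ cong ((mult P + 1) *_) ∑-mult ⟩
    (mult P + 1) * ((q + 1) * q)
      ≡⟨ [m+1]*n≡n+m*n (mult P) ((q + 1) * q) ⟩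
    (q + 1) * q + mult P * ((q + 1) * q)
      ∎)
    where
    open ≤-Reasoning
    [m+1]*n≡n+m*n : ∀ m n → (m + 1) * n ≡ n + m * n
    [m+1]*n≡n+m*n = solve-∀

  module AtPoint (P : Fin (q * q)) where

    onP offP : Fin (q + 1) → Bool
    onP  i = P ∈ₗ L i
    offP i = not (P ∈ₗ L i)

    a b : Fin (q * q) → ℕ
    a = weight ([_] ∘ onP)
    b = weight ([_] ∘ offP)

    M k : ℕ
    M = ∑-indicator onP
    k = ∑-indicator offP

    mult-P≡M : mult P ≡ M
    mult-P≡M = count≡∑ (q + 1) onP

    M+k≡q+1 : M + k ≡ q + 1
    M+k≡q+1 = begin
      M + k                                     ≡⟨ ∑-distrib-+ ([_] ∘ onP) ([_] ∘ offP) ⟨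
      ∑[ i < q + 1 ] ([ onP i ] + [ offP i ])   ≡⟨ sum-cong-≗ (λ i → [b]+[not-b]≡1 (onP i)) ⟩
      ∑[ i < q + 1 ] 1                          ≡⟨ ∑-const (q + 1) 1 ⟩
      (q + 1) * 1                               ≡⟨ *-identityʳ (q + 1) ⟩
      q + 1                                     ∎
      where open ≡-Reasoning

    mult≡a+b : ∀ p → mult p ≡ a p + b p
    mult≡a+b p = begin
      mult p                                     ≡⟨ mult≡weight p ⟩
      ∑[ i < q + 1 ] (1 * incidence i p)         ≡⟨ sum-cong-≗ (λ i → cong (_* incidence i p) ([b]+[not-b]≡1 (onP i))) ⟨
      ∑[ i < q + 1 ] (([ onP i ] + [ offP i ]) * incidence i p)
        ≡⟨ sum-cong-≗ (λ i → *-distribʳ-+ (incidence i p) [ onP i ] [ offP i ]) ⟩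
      ∑[ i < q + 1 ] ([ onP i ] * incidence i p + [ offP i ] * incidence i p)
        ≡⟨ ∑-distrib-+ (λ i → [ onP i ] * incidence i p) (λ i → [ offP i ] * incidence i p) ⟩
      a p + b p                                  ∎
      where open ≡-Reasoning

    a-P≡M : a P ≡ M
    a-P≡M = sum-cong-≗ (λ i → [b]*[b]≡[b] (onP i))

    b-P≡0 : b P ≡ 0
    b-P≡0 = trans (sum-cong-≗ (λ i → trans (*-comm [ offP i ] [ onP i ]) ([b]*[not-b]≡0 (onP i))))
                  (sum-replicate-zero (q + 1))

    ∑a≡M*q : ∑[ p < q * q ] a p ≡ M * q
    ∑a≡M*q = ∑-weight ([_] ∘ onP)

    ∑b≡k*q : ∑[ p < q * q ] b p ≡ k * q
    ∑b≡k*q = ∑-weight ([_] ∘ offP)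

    ∑ab≡M*k : ∑[ p < q * q ] (a p * b p) ≡ M * k
    ∑ab≡M*k = begin
      ∑[ p < q * q ] (a p * b p)                          ≡⟨ +-identityʳ _ ⟨
      ∑[ p < q * q ] (a p * b p) + 0                      ≡⟨ cong (∑[ p < q * q ] (a p * b p) +_) ∑onP*offP≡0 ⟨
      ∑[ p < q * q ] (a p * b p) + ∑[ i < q + 1 ] ([ onP i ] * [ offP i ])
        ≡⟨ ∑-weight*weight+∑ ([_] ∘ onP) ([_] ∘ offP) ⟩
      M * k + q * ∑[ i < q + 1 ] ([ onP i ] * [ offP i ])  ≡⟨ cong (λ s → M * k + q * s) ∑onP*offP≡0 ⟩
      M * k + q * 0                                       ≡⟨ cong (M * k +_) (*-zeroʳ q) ⟩
      M * k + 0                                           ≡⟨ +-identityʳ _ ⟩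
      M * k                                               ∎
      where
      open ≡-Reasoning
      ∑onP*offP≡0 : ∑[ i < q + 1 ] ([ onP i ] * [ offP i ]) ≡ 0
      ∑onP*offP≡0 = trans (sum-cong-≗ (λ i → [b]*[not-b]≡0 (onP i))) (sum-replicate-zero (q + 1))

    ∑b²+k≡k²+q*k : ∑[ p < q * q ] (b p * b p) + k ≡ k * k + q * k
    ∑b²+k≡k²+q*k = ∑-weight[]² offP

    -- Away from P the sums of a and a * a agree, while a ≤ a * a pointwise.
    a≤1 : ∀ p → p ≢ P → a p ≤ 1
    a≤1 p p≢P = m≡m*m⇒m≤1 (a p) (∑-mono-≤-except-rigid P (λ p _ → m≤m*m (a p)) ∑a²+M≤∑a+M² p p≢P)
      where
      ∑a²+M≤∑a+M² : ∑[ p < q * q ] (a p * a p) + a P ≤ ∑[ p < q * q ] a p + a P * a P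
      ∑a²+M≤∑a+M² = ≤-reflexive (begin
        ∑[ p < q * q ] (a p * a p) + a P   ≡⟨ cong (∑[ p < q * q ] (a p * a p) +_) a-P≡M ⟩
        ∑[ p < q * q ] (a p * a p) + M     ≡⟨ ∑-weight[]² onP ⟩
        M * M + q * M                      ≡⟨ +-comm (M * M) (q * M) ⟩
        q * M + M * M                      ≡⟨ cong₂ _+_ (trans (*-comm q M) (sym ∑a≡M*q)) (sym (cong₂ _*_ a-P≡M a-P≡M)) ⟩
        ∑[ p < q * q ] a p + a P * a P     ∎)
        where open ≡-Reasoning

    kakeyaSize≡∑1⊓[a+b] : kakeyaSize A L ≡ ∑[ p < q * q ] (1 ⊓ (a p + b p))
    kakeyaSize≡∑1⊓[a+b] = trans kakeyaSize≡∑ (sum-cong-≗ (λ p → cong (1 ⊓_) (mult≡a+b p)))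

    ∑-mono-≤-offP : (h₁ h₂ : ℕ → ℕ → ℕ) → (∀ x y → x ≤ 1 → h₁ x y ≤ h₂ x y) →
      ∑[ p < q * q ] h₁ (a p) (b p) + h₂ M 0 ≤ ∑[ p < q * q ] h₂ (a p) (b p) + h₁ M 0
    ∑-mono-≤-offP h₁ h₂ h₁≤h₂ =
      subst₂ (λ x y → ∑[ p < q * q ] h₁ (a p) (b p) + h₂ x y ≤ ∑[ p < q * q ] h₂ (a p) (b p) + h₁ x y)
        a-P≡M b-P≡0 (∑-mono-≤-except P (λ p p≢P → h₁≤h₂ (a p) (b p) (a≤1 p p≢P)))

    ∑[a+b]≡M*q+k*q : ∑[ p < q * q ] (a p + b p) ≡ M * q + k * q
    ∑[a+b]≡M*q+k*q = trans (∑-distrib-+ a b) (cong₂ _+_ ∑a≡M*q ∑b≡k*q)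

    ∑[2a+3b]≡2Mq+3kq : ∑[ p < q * q ] (2 * a p + 3 * b p) ≡ 2 * (M * q) + 3 * (k * q)
    ∑[2a+3b]≡2Mq+3kq = trans (∑-distrib-+ (λ p → 2 * a p) (λ p → 3 * b p)) (cong₂ _+_
      (trans (sym (*-distribˡ-sum 2 a)) (cong (2 *_) ∑a≡M*q))
      (trans (sym (*-distribˡ-sum 3 b)) (cong (3 *_) ∑b≡k*q)))

    ∑[1⊓[a+b]+ab]≡K+Mk : ∑[ p < q * q ] (1 ⊓ (a p + b p) + a p * b p) ≡ kakeyaSize A L + M * k
    ∑[1⊓[a+b]+ab]≡K+Mk = trans (∑-distrib-+ (λ p → 1 ⊓ (a p + b p)) (λ p → a p * b p))
                                (cong₂ _+_ (sym kakeyaSize≡∑1⊓[a+b]) ∑ab≡M*k)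

    ∑[2[1⊓[a+b]]+2ab+b²]≡2K+2Mk+∑b² :
      ∑[ p < q * q ] (2 * (1 ⊓ (a p + b p)) + 2 * (a p * b p) + b p * b p)
        ≡ 2 * kakeyaSize A L + 2 * (M * k) + ∑[ p < q * q ] (b p * b p)
    ∑[2[1⊓[a+b]]+2ab+b²]≡2K+2Mk+∑b² = begin
      ∑[ p < q * q ] (2 * (1 ⊓ (a p + b p)) + 2 * (a p * b p) + b p * b p)
        ≡⟨ ∑-distrib-+ (λ p → 2 * (1 ⊓ (a p + b p)) + 2 * (a p * b p)) (λ p → b p * b p) ⟩
      ∑[ p < q * q ] (2 * (1 ⊓ (a p + b p)) + 2 * (a p * b p)) + ∑b²
        ≡⟨ cong (_+ ∑b²) (∑-distrib-+ (λ p → 2 * (1 ⊓ (a p + b p))) (λ p → 2 * (a p * b p))) ⟩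
      ∑[ p < q * q ] (2 * (1 ⊓ (a p + b p))) + ∑[ p < q * q ] (2 * (a p * b p)) + ∑b²
        ≡⟨ cong (_+ ∑b²) (cong₂ _+_
             (trans (sym (*-distribˡ-sum 2 (λ p → 1 ⊓ (a p + b p)))) (cong (2 *_) (sym kakeyaSize≡∑1⊓[a+b])))
             (trans (sym (*-distribˡ-sum 2 (λ p → a p * b p))) (cong (2 *_) ∑ab≡M*k))) ⟩
      2 * kakeyaSize A L + 2 * (M * k) + ∑b²
        ∎
      where
      open ≡-Reasoning
      ∑b² = ∑[ p < q * q ] (b p * b p)

    kakeyaSize-upper : 1 ≤ M → kakeyaSize A L + M * k + M ≤ M * q + k * q + 1
    kakeyaSize-upper 1≤M = begin
      kakeyaSize A L + M * k + M
        ≡⟨ cong₂ _+_ ∑[1⊓[a+b]+ab]≡K+Mk (+-identityʳ M) ⟨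
      ∑[ p < q * q ] (1 ⊓ (a p + b p) + a p * b p) + (M + 0)
        ≤⟨ ∑-mono-≤-offP (λ x y → 1 ⊓ (x + y) + x * y) _+_ 1⊓[x+y]+x*y≤x+y ⟩
      ∑[ p < q * q ] (a p + b p) + (1 ⊓ (M + 0) + M * 0)
        ≡⟨ cong₂ _+_ ∑[a+b]≡M*q+k*q (cong₂ _+_ (1⊓[m+0]≡1 1≤M) (*-zeroʳ M)) ⟩
      M * q + k * q + 1
        ∎
      where open ≤-Reasoning

    kakeyaSize-lower : 1 ≤ M →
      2 * (M * q) + 3 * (k * q) + 2 + k ≤ 2 * kakeyaSize A L + 2 * (M * k) + (k * k + q * k) + 2 * M
    kakeyaSize-lower 1≤M = begin
      2 * (M * q) + 3 * (k * q) + 2 + k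
        ≡⟨ cong (_+ k) (cong₂ _+_ ∑[2a+3b]≡2Mq+3kq g-P≡2) ⟨
      ∑[ p < q * q ] (2 * a p + 3 * b p) + g M 0 + k
        ≤⟨ +-monoˡ-≤ k (∑-mono-≤-offP (λ x y → 2 * x + 3 * y) g 2*x+3*y≤2*[1⊓[x+y]]+2*[x*y]+y*y) ⟩
      ∑[ p < q * q ] g (a p) (b p) + (2 * M + 3 * 0) + k
        ≡⟨ cong (λ x → x + (2 * M + 3 * 0) + k) ∑[2[1⊓[a+b]]+2ab+b²]≡2K+2Mk+∑b² ⟩
      2K+2Mk + ∑b² + (2 * M + 3 * 0) + k
        ≡⟨ xy∙z≈xz∙y (2K+2Mk + ∑b²) (2 * M + 3 * 0) k ⟩
      2K+2Mk + ∑b² + k + (2 * M + 3 * 0)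
        ≡⟨ cong₂ _+_ (trans (+-assoc 2K+2Mk ∑b² k) (cong (2K+2Mk +_) ∑b²+k≡k²+q*k)) (+-identityʳ (2 * M)) ⟩
      2K+2Mk + (k * k + q * k) + 2 * M
        ∎
      where
      open ≤-Reasoning
      2K+2Mk = 2 * kakeyaSize A L + 2 * (M * k)
      ∑b² = ∑[ p < q * q ] (b p * b p)
      g : ℕ → ℕ → ℕ
      g x y = 2 * (1 ⊓ (x + y)) + 2 * (x * y) + y * y
      g-P≡2 : g M 0 ≡ 2
      g-P≡2 = cong₂ (λ u v → 2 * u + 2 * v + 0) (1⊓[m+0]≡1 1≤M) (*-zeroʳ M)

    M≡q+1∸k : M ≡ q + 1 ∸ k
    M≡q+1∸k = trans (sym (m+n∸n≡m M k)) (cong (_∸ k) M+k≡q+1)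

    1≤M : k ≤ q → 1 ≤ M
    1≤M k≤q = subst (1 ≤_) (sym M≡q+1∸k) (m<n⇒0<n∸m (≤-<-trans k≤q (m<m+n q z<s)))

    kakeyaSize+k*q≤q*q+k*k : 1 ≤ M → kakeyaSize A L + k * q ≤ q * q + k * k
    kakeyaSize+k*q≤q*q+k*k 1≤M = knot-upper-arith 1≤M M+k≡q+1 (kakeyaSize-upper 1≤M)

    kakeyaSize≤ : k ≤ q → kakeyaSize A L ≤ q * q ∸ k * q + k * k
    kakeyaSize≤ k≤q = m+n≤o+p⇒m≤o∸n+p (kakeyaSize+k*q≤q*q+k*k (1≤M k≤q)) (*-monoˡ-≤ q k≤q)

    ≤kakeyaSize : k ≤ q → q * q ∸ k * q + (k * (k + 1)) / 2 ≤ kakeyaSize A L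
    ≤kakeyaSize k≤q = 2*m+n≤2*o⇒m+n/2≤o (q * q ∸ k * q) (k * (k + 1)) (kakeyaSize A L) (begin
      2 * (q * q ∸ k * q) + k * (k + 1)            ≡⟨ cong (_+ k * (k + 1)) (*-distribˡ-∸ 2 (q * q) (k * q)) ⟩
      2 * (q * q) ∸ 2 * (k * q) + k * (k + 1)     ≤⟨ m+n≤o+p⇒m∸p+n≤o lower (*-monoʳ-≤ 2 (*-monoˡ-≤ q k≤q)) ⟩
      2 * kakeyaSize A L                          ∎)
      where
      open ≤-Reasoning
      lower : 2 * (q * q) + k * (k + 1) ≤ 2 * kakeyaSize A L + 2 * (k * q)
      lower = knot-lower-arith {K = kakeyaSize A L} (1≤M k≤q) M+k≡q+1 (kakeyaSize-lower (1≤M k≤q))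

    maximal⇒k≤s : ∀ {s} → q ≡ s * s → 1 ≤ q → q * q + q + 1 ≤ kakeyaSize A L + q * s →
                  (∀ p → mult p ≤ mult P) → k ≤ s
    maximal⇒k≤s {s} q≡s² 1≤q large maximal with k ≤? s | M ≤? s
    ... | yes k≤s | _       = k≤s
    ... | no k≰s  | yes M≤s = ⊥-elim (knot-small-arith q≡s² 1≤q (subst (_≤ s) (sym mult-P≡M) M≤s)
                                  (maxKnot-bound P maximal) large)
    ... | no k≰s  | no M≰s  = ⊥-elim (knot-mid-arith q≡s² M+k≡q+1 (≰⇒> k≰s) (≰⇒> M≰s)
                                (kakeyaSize+k*q≤q*q+k*k (≤-trans (s≤s z≤n) (≰⇒> M≰s))) large)

corollary2p8 : (s q : ℕ) → q ≡ s * s → 9 ≤ q →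
    (A : AffinePlane q) → (L : Fin (q + 1) → Fin (q * q + q)) →
    (∀ i j → i ≢ j → AffinePlane.parClass A (L i) ≢ AffinePlane.parClass A (L j)) →
    q * q ∸ q * s + q < kakeyaSize A L →
    Σ ℕ (λ k → k ≤ s ×
      (∃ λ p → IsKnot A L (q + 1 ∸ k) p) ×
      (q * q ∸ k * q + (k * (k + 1)) / 2 ≤ kakeyaSize A L) ×
      (kakeyaSize A L ≤ q * q ∸ k * q + k * k))
corollary2p8 s q q≡s² 9≤q A L L-nonParallel q²-qs+q<K =
  k , k≤s , (P , trans mult-P≡M M≡q+1∸k) , ≤kakeyaSize k≤q , kakeyaSize≤ k≤q
  where
  open KakeyaCounting A L L-nonParallel
  1≤q : 1 ≤ q
  1≤q = ≤-trans (s≤s z≤n) 9≤q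
  s≤q : s ≤ q
  s≤q = ≤-trans (m≤m*m s) (≤-reflexive (sym q≡s²))
  maxKnot : ∃ λ P → ∀ p → mult p ≤ mult P
  maxKnot = argmax (fromℕ< (*-mono-≤ 1≤q 1≤q)) mult
  P = proj₁ maxKnot
  open AtPoint P
  k≤s : k ≤ s
  k≤s = maximal⇒k≤s q≡s² 1≤q (m∸n+o<p⇒m+o+1≤p+n (*-monoʳ-≤ q s≤q) q²-qs+q<K) (proj₂ maxKnot)
  k≤q : k ≤ q
  k≤q = ≤-trans k≤s s≤q
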